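{- Let $u\in\mathbb{Q}^\times$, $f=x^2-u^2\in\mathbb{Q}[x]$, and let $\mathfrak c_1=-f(0)=u^2$, $\mathfrak c_{k+1}=f(\mathfrak c_k)$ for $k\ge1$. Let $n\ge1$ and let $a$ be a squarefree integer lying (as a class) in both $\langle\mathfrak c_1-u,\mathfrak c_2+u,\ldots,\mathfrak c_n+u\rangle_{\mathbb{Q}}$ and $\langle\mathfrak c_1+u,\mathfrak c_2-u,\ldots,\mathfrak c_n-u\rangle_{\mathbb{Q}}$. If $p$ is a prime with $p\mid a$, then $v_p(2\mathfrak c_1)\ne0$.
   Context: For non-zero $b_1,\ldots,b_m\in\mathbb{Q}$, $\langle b_1,\ldots,b_m\rangle_{\mathbb{Q}}$ denotes the $\mathbb{F}_2$-span of their classes in the $\mathbb{F}_2$-vector space $\mathbb{Q}^\times/(\mathbb{Q}^\times)^2$ (so the listed elements are implicitly non-zero). $v_p$ is the $p$-adic valuation. -}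

module Defs where

open import Data.Bool using (Bool; true; false; if_then_else_)
open import Data.Nat as ℕ using (ℕ; zero; suc; NonZero)
open import Data.Nat.DivMod using (_/_)
open import Data.Nat.Divisibility using (_∣?_; _∤_; _∣_)
open import Data.Nat.Primality using (Prime)
open import Data.Fin using (Fin)
import Data.Fin as Fin
open import Data.Integer as ℤ using (ℤ; +_; ∣_∣)
open import Data.Rational as ℚ using (ℚ; _*_; _+_; _-_; ↥_; ↧ₙ_)
open import Data.Product using (Σ; ∃; ∃-syntax; _×_)
open import Relation.Binary.PropositionalEquality using (_≡_; _≢_)
open import Relation.Nullary.Decidable using (does)

-- The sequence 𝔠 for f = x² - u²:  orbit u k = 𝔠_{k+1},
-- i.e. orbit u 0 = 𝔠₁ = -f(0) = u², orbit u (k+1) = f(orbit u k).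
orbit : ℚ → ℕ → ℚ
orbit u zero    = u * u
orbit u (suc k) = orbit u k * orbit u k - u * u

prodFin : (n : ℕ) → (Fin n → ℚ) → ℚ
prodFin zero    b = ℚ.1ℚ
prodFin (suc n) b = b Fin.zero * prodFin n (λ i → b (Fin.suc i))

-- x ∈ ⟨b₁,…,bₙ⟩_ℚ : the class of x in ℚ^×/(ℚ^×)² lies in the F₂-span of
-- the classes of the bᵢ, i.e. x = q² · ∏ bᵢ^{eᵢ} for some eᵢ ∈ {0,1}, q ∈ ℚ^×.
InSpan : (n : ℕ) → (Fin n → ℚ) → ℚ → Set
InSpan n b x =
  Σ (Fin n → Bool) λ e → ∃[ q ] (q ≢ ℚ.0ℚ × x ≡ q * q * prodFin n (λ i → if e i then b i else ℚ.1ℚ))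

-- generators 𝔠₁ - u, 𝔠₂ + u, …, 𝔠ₙ + u  (index i : Fin n stands for i+1)
gensMinus : ℚ → (n : ℕ) → Fin n → ℚ
gensMinus u n Fin.zero    = orbit u 0 - u
gensMinus u n (Fin.suc i) = orbit u (suc (Fin.toℕ i)) + u

gensPlus : ℚ → (n : ℕ) → Fin n → ℚ
gensPlus u n Fin.zero    = orbit u 0 + u
gensPlus u n (Fin.suc i) = orbit u (suc (Fin.toℕ i)) - u

SquarefreeInt : ℤ → Set
SquarefreeInt a = (a ≢ + 0) × (∀ p → Prime p → p ℕ.* p ∤ ∣ a ∣)

-- p-adic valuation of a natural number (0 ↦ 0 by convention; fuel m suffices)
valℕ-fuel : ℕ → ℕ → ℕ → ℕ
valℕ-fuel zero    p m = 0
valℕ-fuel (suc f) zero m = 0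
valℕ-fuel (suc f) (suc zero) m = 0
valℕ-fuel (suc f) p@(suc (suc _)) zero = 0
valℕ-fuel (suc f) p@(suc (suc _)) m@(suc _) =
  if does (p ∣? m) then suc (valℕ-fuel f p (m / p)) else 0

valℕ : ℕ → ℕ → ℕ
valℕ p m = valℕ-fuel m p m

-- p-adic valuation v_p on ℚ (for q = r/s in lowest terms: v_p(r) - v_p(s);
-- v_p(0) = 0 by convention, only used on nonzero arguments)
vₚ : ℕ → ℚ → ℤ
vₚ p q = + valℕ p ∣ ↥ q ∣ ℤ.- + valℕ p (↧ₙ q)

toℚ : ℤ → ℚ
toℚ a = a ℚ./ 1

{-# OPTIONS --safe #-}
module Submission where

-- Suppose vₚ(2u²) = 0. Then p is odd and u is a p-adic unit, so u ≡ w (mod p) for an integer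
-- w prime to p. Put x₀ = 0 and xₖ₊₁ = xₖ² − w² = (xₖ − w)(xₖ + w); modulo p, 𝔠₁ ≡ −x₁ and
-- 𝔠ₖ ≡ xₖ for k ≥ 2, so up to sign the generators of the first family reduce to the xₖ + w and
-- those of the second to the xₖ − w. If p divided some xₖ + w and some xⱼ − w, then
-- xₖ₊₁ ≡ 0 ≡ xⱼ₊₁; the return times of the orbit of 0 to 0 are closed under Euclid's algorithm,
-- so xₖ ≡ xⱼ and p ∣ 2w, which is impossible. Hence all generators of one family are p-adic
-- units, and an element a = q² · (unit) of their span has even valuation at p, contradicting
-- p ∣ a with a squarefree.

open import Data.Bool using (true; false; if_then_else_)
open import Data.Bool.Properties using (if-cong)
open import Data.Empty using (⊥; ⊥-elim)
open import Data.Fin using (Fin; zero; suc; toℕ)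
open import Data.Integer as ℤ using (ℤ; +_; -_; _+_; _*_; _-_; 0ℤ; 1ℤ)
import Data.Integer.Properties as ℤ
open import Data.Integer.Divisibility.Signed
  using (_∣_; divides; _∣?_; ∣ᵤ⇒∣; ∣⇒∣ᵤ; ∣-refl; ∣m∣n⇒∣m+n; ∣m∣n⇒∣m-n; ∣m⇒∣-m; ∣n⇒∣m*n; ∣m⇒∣m*n)
open import Data.Integer.Tactic.RingSolver using (solve-∀)
open import Data.Nat as ℕ using (ℕ; zero; suc; _≥_)
open import Data.Nat.Coprimality as ℕ using (Coprime; coprime-Bézout)
open import Data.Nat.Divisibility as ℕ using ()
open import Data.Nat.GCD using (module Bézout)
open import Data.Nat.GeneralisedArithmetic using (fold; fold-+)
open import Data.Nat.Induction using (<-wellFounded)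
open import Data.Nat.Primality
  using (Prime; ¬prime[1]; euclidsLemma; prime⇒irreducible; prime⇒nonZero; prime⇒nonTrivial)
open import Data.Nat.Properties as ℕ using (<-cmp; +-comm; +-monoʳ-<; m∸n+n≡m; m<m+n)
open import Data.Product using (_,_; ∃; _×_; proj₁; proj₂)
open import Data.Rational as ℚ using (ℚ; mkℚ; ↥_; ↧_; ↧ₙ_; toℚᵘ)
import Data.Rational.Properties as ℚ
open import Data.Rational.Unnormalised as ℚᵘ using (ℚᵘ; mkℚᵘ; *≡*)
  renaming (↥_ to ↥ᵘ_; ↧_ to ↧ᵘ_; _≃_ to _≃ᵘ_)
import Data.Rational.Unnormalised.Properties as ℚᵘ
open import Data.Sum as Sum using (_⊎_; inj₁; inj₂; [_,_])
open import Function using (id; _∘_)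
open import Induction.WellFounded using (Acc; acc)
open import Level using (0ℓ)
open import Relation.Binary.Bundles using (Setoid)
open import Relation.Binary.Definitions using (tri<; tri≈; tri>)
open import Relation.Binary.PropositionalEquality as ≡ using (_≡_; _≢_; module ≡-Reasoning)
import Relation.Binary.Reasoning.Setoid as SetoidReasoning
open import Relation.Nullary using (¬_; yes; no)
open import Relation.Nullary.Decidable using (dec-true; dec-false; decidable-stable)

open import Defs

module _ {c ℓ} (S : Setoid c ℓ) where
  open Setoid S

  fold-congˡ : ∀ {f} → (∀ {x y} → x ≈ y → f x ≈ f y) →
               ∀ {x y} → x ≈ y → ∀ n → fold x f n ≈ fold y f n
  fold-congˡ f-cong x≈y zero    = x≈y
  fold-congˡ f-cong x≈y (suc n) = f-cong (fold-congˡ f-cong x≈y n)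

  module _ {f : Carrier → Carrier} (f-cong : ∀ {x y} → x ≈ y → f x ≈ f y) {x₀ : Carrier} where

    fold-periodic : ∀ {m} → fold x₀ f m ≈ x₀ → ∀ n → fold x₀ f (n ℕ.+ m) ≈ fold x₀ f n
    fold-periodic {m} xₘ≈x₀ n = begin
      fold x₀ f (n ℕ.+ m)     ≡⟨ fold-+ x₀ f n ⟩
      fold (fold x₀ f m) f n  ≈⟨ fold-congˡ f-cong xₘ≈x₀ n ⟩
      fold x₀ f n             ∎
      where open SetoidReasoning S

    -- Euclid's algorithm on the return times k + 1 and j + 1.
    fold-return⇒pred-≈ : ∀ k j → fold x₀ f (suc k) ≈ x₀ → fold x₀ f (suc j) ≈ x₀ →
                         fold x₀ f k ≈ fold x₀ f j
    fold-return⇒pred-≈ k j = go k j (<-wellFounded (k ℕ.+ j))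
      where
      descend : ∀ k d → fold x₀ f (suc k) ≈ x₀ → fold x₀ f (suc (d ℕ.+ suc k)) ≈ x₀ →
                (fold x₀ f (suc d) ≈ x₀ → fold x₀ f k ≈ fold x₀ f d) →
                fold x₀ f k ≈ fold x₀ f (d ℕ.+ suc k)
      descend k d returnₖ returnⱼ ih =
        trans (ih (trans (sym (fold-periodic returnₖ (suc d))) returnⱼ)) (sym (fold-periodic returnₖ d))

      shrink : ∀ a d b → a ℕ.+ d ℕ.< a ℕ.+ (d ℕ.+ suc b)
      shrink a d b = +-monoʳ-< a (m<m+n d (ℕ.s≤s ℕ.z≤n))

      go : ∀ k j → Acc ℕ._<_ (k ℕ.+ j) → fold x₀ f (suc k) ≈ x₀ → fold x₀ f (suc j) ≈ x₀ →
           fold x₀ f k ≈ fold x₀ f j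
      go k j (acc rs) returnₖ returnⱼ with <-cmp k j
      ... | tri≈ _ ≡.refl _ = refl
      ... | tri< k<j _ _ with j ℕ.∸ suc k | m∸n+n≡m k<j
      ...   | d | ≡.refl =
        descend k d returnₖ returnⱼ (go k d (rs (shrink k d k)) returnₖ)
      go k j (acc rs) returnₖ returnⱼ | tri> _ _ j<k with k ℕ.∸ suc j | m∸n+n≡m j<k
      ...   | d | ≡.refl =
        sym (descend j d returnⱼ returnₖ (go j d (rs (≡.subst (j ℕ.+ d ℕ.<_) (+-comm j _) (shrink j d j))) returnⱼ))

≡-mod-setoid : ℤ → Setoid 0ℓ 0ℓ
≡-mod-setoid m = record
  { Carrier       = ℤ
  ; _≈_           = λ a b → m ∣ a - b
  ; isEquivalence = record
    { refl  = λ {a} → ≡.subst (m ∣_) (≡.sym (ℤ.+-inverseʳ a)) (∣n⇒∣m*n 0ℤ ∣-refl)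
    ; sym   = λ {a} {b} h → ≡.subst (m ∣_) (negate a b) (∣m⇒∣-m h)
    ; trans = λ {a} {b} {c} h g → ≡.subst (m ∣_) (chain a b c) (∣m∣n⇒∣m+n h g)
    }
  }
  where
  negate : ∀ a b → - (a - b) ≡ b - a
  negate = solve-∀
  chain : ∀ a b c → (a - b) + (b - c) ≡ a - c
  chain = solve-∀

zeroOrbit : ℤ → ℕ → ℤ
zeroOrbit w = fold 0ℤ (λ x → x * x - w * w)

zeroOrbit-suc : ∀ w k → zeroOrbit w (suc k) ≡ (zeroOrbit w k - w) * (zeroOrbit w k + w)
zeroOrbit-suc w k = difference-of-squares (zeroOrbit w k) w
  where
  difference-of-squares : ∀ x w → x * x - w * w ≡ (x - w) * (x + w)
  difference-of-squares = solve-∀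

∣zeroOrbit±w⇒∣2w : ∀ {m} w k j → m ∣ zeroOrbit w k + w → m ∣ zeroOrbit w j - w → m ∣ + 2 * w
∣zeroOrbit±w⇒∣2w {m} w k j m∣xₖ+w m∣xⱼ-w =
  ≡.subst (m ∣_) (cancel (zeroOrbit w k) (zeroOrbit w j) w) (∣m∣n⇒∣m-n (∣m∣n⇒∣m-n m∣xₖ+w m∣xⱼ-w) xₖ≈xⱼ)
  where
  open Setoid (≡-mod-setoid m) using (_≈_)
  square-cong : ∀ x y → x ≈ y → (x * x - w * w) ≈ (y * y - w * w)
  square-cong x y x≈y = ≡.subst (m ∣_) (≡.sym (factor x y w)) (∣m⇒∣m*n (x + y) x≈y)
    where
    factor : ∀ x y w → (x * x - w * w) - (y * y - w * w) ≡ (x - y) * (x + y)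
    factor = solve-∀
  root⇒return : ∀ i → m ∣ (zeroOrbit w i - w) * (zeroOrbit w i + w) → zeroOrbit w (suc i) ≈ 0ℤ
  root⇒return i = ≡.subst (m ∣_) (≡.trans (≡.sym (zeroOrbit-suc w i)) (≡.sym (ℤ.+-identityʳ _)))
  xₖ≈xⱼ : zeroOrbit w k ≈ zeroOrbit w j
  xₖ≈xⱼ = fold-return⇒pred-≈ (≡-mod-setoid m) {f = λ x → x * x - w * w} (λ {x} {y} → square-cong x y) k j
    (root⇒return k (∣n⇒∣m*n (zeroOrbit w k - w) m∣xₖ+w)) (root⇒return j (∣m⇒∣m*n _ m∣xⱼ-w))
  cancel : ∀ x y w → ((x + w) - (y - w)) - (x - y) ≡ + 2 * w
  cancel = solve-∀

valℕ≢0⇒∣ : ∀ p m → valℕ p m ≢ 0 → p ℕ.∣ m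
valℕ≢0⇒∣ p               zero    _   = p ℕ.∣0
valℕ≢0⇒∣ zero            (suc m) v≢0 = ⊥-elim (v≢0 ≡.refl)
valℕ≢0⇒∣ (suc zero)      (suc m) v≢0 = ⊥-elim (v≢0 ≡.refl)
valℕ≢0⇒∣ p@(suc (suc _)) (suc m) v≢0 =
  decidable-stable (p ℕ.∣? suc m) (λ p∤m → v≢0 (if-cong (dec-false (p ℕ.∣? suc m) p∤m)))

∣⇒valℕ≢0 : ∀ {p m} .{{_ : ℕ.NonTrivial p}} → m ≢ 0 → p ℕ.∣ m → valℕ p m ≢ 0
∣⇒valℕ≢0 {suc (suc _)}     {zero}  m≢0 _   = ⊥-elim (m≢0 ≡.refl)
∣⇒valℕ≢0 {p@(suc (suc _))} {suc m} _   p∣m v≡0 =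
  ℕ.1+n≢0 (≡.trans (≡.sym (if-cong (dec-true (p ℕ.∣? suc m) p∣m))) v≡0)

∀⊎∃ : ∀ {n} {A B : Fin n → Set} → (∀ i → A i ⊎ B i) → (∀ i → A i) ⊎ ∃ B
∀⊎∃ {zero}  _ = inj₁ λ ()
∀⊎∃ {suc n} a⊎b with a⊎b zero | ∀⊎∃ (a⊎b ∘ suc)
... | inj₂ b | _            = inj₂ (zero , b)
... | inj₁ _ | inj₂ (i , b) = inj₂ (suc i , b)
... | inj₁ a | inj₁ as      = inj₁ λ { zero → a ; (suc i) → as i }

toℚ≡q²v⇒cross : ∀ a q v → toℚ a ≡ q ℚ.* q ℚ.* v → a * (↧ q * ↧ q * ↧ v) ≡ ↥ q * ↥ q * ↥ v
toℚ≡q²v⇒cross a q@(mkℚ _ _ _) v@(mkℚ _ _ _) a≡qqv with a≃qqv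
  where
  open ℚᵘ.≃-Reasoning
  a≃qqv : mkℚᵘ a 0 ≃ᵘ toℚᵘ q ℚᵘ.* toℚᵘ q ℚᵘ.* toℚᵘ v
  a≃qqv = begin
    mkℚᵘ a 0                        ≈⟨ ℚ.toℚᵘ-fromℚᵘ (mkℚᵘ a 0) ⟨
    toℚᵘ (toℚ a)                    ≈⟨ ℚ.toℚᵘ-cong a≡qqv ⟩
    toℚᵘ (q ℚ.* q ℚ.* v)            ≈⟨ ℚ.toℚᵘ-homo-* (q ℚ.* q) v ⟩
    toℚᵘ (q ℚ.* q) ℚᵘ.* toℚᵘ v      ≈⟨ ℚᵘ.*-congʳ (ℚ.toℚᵘ-homo-* q q) ⟩
    toℚᵘ q ℚᵘ.* toℚᵘ q ℚᵘ.* toℚᵘ v  ∎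
... | *≡* eq = ≡.trans eq (ℤ.*-identityʳ _)

toℚ*q²≡x⇒cross : ∀ a q x → toℚ a ℚ.* (q ℚ.* q) ≡ x → a * (↥ q * ↥ q * ↧ x) ≡ ↧ q * ↧ q * ↥ x
toℚ*q²≡x⇒cross a q@(mkℚ r s _) x@(mkℚ n d _) aqq≡x with x≃aqq
  where
  open ℚᵘ.≃-Reasoning
  x≃aqq : toℚᵘ x ≃ᵘ mkℚᵘ a 0 ℚᵘ.* (toℚᵘ q ℚᵘ.* toℚᵘ q)
  x≃aqq = begin
    toℚᵘ x                              ≈⟨ ℚ.toℚᵘ-cong aqq≡x ⟨
    toℚᵘ (toℚ a ℚ.* (q ℚ.* q))          ≈⟨ ℚ.toℚᵘ-homo-* (toℚ a) (q ℚ.* q) ⟩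
    toℚᵘ (toℚ a) ℚᵘ.* toℚᵘ (q ℚ.* q)    ≈⟨ ℚᵘ.*-cong (ℚ.toℚᵘ-fromℚᵘ (mkℚᵘ a 0)) (ℚ.toℚᵘ-homo-* q q) ⟩
    mkℚᵘ a 0 ℚᵘ.* (toℚᵘ q ℚᵘ.* toℚᵘ q)  ∎
... | *≡* eq = ≡.trans (regroup a r (+ suc s) (+ suc d)) (≡.trans (≡.sym eq) (regroup′ n (+ suc s)))
  where
  regroup : ∀ a r s d → a * (r * r * d) ≡ a * (r * r) * d
  regroup = solve-∀
  regroup′ : ∀ n s → n * (+ 1 * (s * s)) ≡ s * s * n
  regroup′ = solve-∀

↥[toℚ*q²]≢0 : ∀ A q → A ≢ 0ℤ → q ≢ ℚ.0ℚ → ↥ (toℚ A ℚ.* (q ℚ.* q)) ≢ 0ℤ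
↥[toℚ*q²]≢0 A q A≢0 q≢0 ↥≡0 with ℤ.i*j≡0⇒i≡0∨j≡0 A A*qqd≡0
  where
  A*qqd≡0 : A * (↥ q * ↥ q * ↧ (toℚ A ℚ.* (q ℚ.* q))) ≡ 0ℤ
  A*qqd≡0 = ≡.trans (toℚ*q²≡x⇒cross A q _ ≡.refl)
                    (≡.trans (≡.cong (↧ q * ↧ q *_) ↥≡0) (ℤ.*-zeroʳ (↧ q * ↧ q)))
... | inj₁ A≡0   = A≢0 A≡0
... | inj₂ qqd≡0 with ℤ.i*j≡0⇒i≡0∨j≡0 (↥ q * ↥ q) qqd≡0
...   | inj₂ ()
...   | inj₁ qq≡0 = q≢0 (ℚ.↥p≡0⇒p≡0 q ([ id , id ] (ℤ.i*j≡0⇒i≡0∨j≡0 (↥ q) qq≡0)))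

module _ {p : ℕ} (p-prime : Prime p) where

  instance
    p-nonTrivial : ℕ.NonTrivial p
    p-nonTrivial = prime⇒nonTrivial p-prime
    p-nonZero : ℕ.NonZero p
    p-nonZero = prime⇒nonZero p-prime

  p∤1 : ¬ + p ∣ 1ℤ
  p∤1 p∣1 = ¬prime[1] (≡.subst Prime (ℕ.∣1⇒≡1 (∣⇒∣ᵤ p∣1)) p-prime)

  p²∤2 : ¬ + p * + p ∣ + 2
  p²∤2 p²∣2 with ℕ.≤-trans 4≤p² (ℕ.∣⇒≤ (≡.subst (ℕ._∣ 2) (ℤ.abs-* (+ p) (+ p)) (∣⇒∣ᵤ p²∣2)))
    where
    4≤p² : 4 ℕ.≤ p ℕ.* p
    4≤p² = ℕ.*-mono-≤ (ℕ.nonTrivial⇒n>1 p) (ℕ.nonTrivial⇒n>1 p)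
  ... | ℕ.s≤s (ℕ.s≤s ())

  euclidsLemmaℤ : ∀ i j → + p ∣ i * j → + p ∣ i ⊎ + p ∣ j
  euclidsLemmaℤ i j p∣ij = Sum.map ∣ᵤ⇒∣ ∣ᵤ⇒∣
    (euclidsLemma ℤ.∣ i ∣ ℤ.∣ j ∣ p-prime (≡.subst (p ℕ.∣_) (ℤ.abs-* i j) (∣⇒∣ᵤ p∣ij)))

  ∤-* : ∀ {i j} → ¬ + p ∣ i → ¬ + p ∣ j → ¬ + p ∣ i * j
  ∤-* {i} {j} p∤i p∤j p∣ij = [ p∤i , p∤j ] (euclidsLemmaℤ i j p∣ij)

  ∣*∤⇒∣ : ∀ {i j} → + p ∣ i * j → ¬ + p ∣ j → + p ∣ i
  ∣*∤⇒∣ {i} {j} p∣ij p∤j = [ id , (λ p∣j → ⊥-elim (p∤j p∣j)) ] (euclidsLemmaℤ i j p∣ij)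

  ∣²⇒∣ : ∀ {i} → + p ∣ i * i → + p ∣ i
  ∣²⇒∣ {i} p∣ii = [ id , id ] (euclidsLemmaℤ i i p∣ii)

  ∤⇒coprime : ∀ {d} → ¬ p ℕ.∣ d → Coprime d p
  ∤⇒coprime p∤d (e∣d , e∣p) with prime⇒irreducible p-prime e∣p
  ... | inj₁ e≡1    = e≡1
  ... | inj₂ ≡.refl = ⊥-elim (p∤d e∣d)

  inverse-mod : ∀ {d} → ¬ + p ∣ + d → ∃ λ t → + p ∣ 1ℤ - t * + d
  inverse-mod {d} p∤d with coprime-Bézout (∤⇒coprime (p∤d ∘ ∣ᵤ⇒∣))
  ... | Bézout.+- x y eq = + x , ≡.subst (+ p ∣_) (≡.sym (begin
    1ℤ - + x * + d          ≡⟨ ≡.cong (λ n → 1ℤ - n) (ℤ.pos-* x d) ⟨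
    1ℤ - + (x ℕ.* d)        ≡⟨ ≡.cong (λ n → 1ℤ - + n) eq ⟨
    1ℤ - + (1 ℕ.+ y ℕ.* p)  ≡⟨ ≡.cong (λ n → 1ℤ - n) (ℤ.pos-+ 1 (y ℕ.* p)) ⟩
    1ℤ - (1ℤ + + (y ℕ.* p)) ≡⟨ cancel (+ (y ℕ.* p)) ⟩
    - + (y ℕ.* p)           ≡⟨ ≡.cong -_ (ℤ.pos-* y p) ⟩
    - (+ y * + p)           ∎)) (∣m⇒∣-m (∣n⇒∣m*n (+ y) ∣-refl))
    where
    open ≡-Reasoning
    cancel : ∀ n → 1ℤ - (1ℤ + n) ≡ - n
    cancel = solve-∀
  ... | Bézout.-+ x y eq = - + x , ≡.subst (+ p ∣_) (≡.sym (begin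
    1ℤ - (- + x) * + d      ≡⟨ negate (+ x) (+ d) ⟩
    1ℤ + + x * + d          ≡⟨ ≡.cong (λ n → 1ℤ + n) (ℤ.pos-* x d) ⟨
    1ℤ + + (x ℕ.* d)        ≡⟨ ℤ.pos-+ 1 (x ℕ.* d) ⟨
    + (1 ℕ.+ x ℕ.* d)       ≡⟨ ≡.cong +_ eq ⟩
    + (y ℕ.* p)             ≡⟨ ℤ.pos-* y p ⟩
    + y * + p               ∎)) (∣n⇒∣m*n (+ y) ∣-refl)
    where
    open ≡-Reasoning
    negate : ∀ x d → 1ℤ - (- x) * d ≡ 1ℤ + x * d
    negate = solve-∀

  ↥↧-coprime : ∀ q → + p ∣ ↥ q → + p ∣ ↧ q → ⊥
  ↥↧-coprime (mkℚ n d c) p∣n p∣d =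
    ¬prime[1] (≡.subst Prime (ℕ.recompute c (∣⇒∣ᵤ p∣n , ∣⇒∣ᵤ p∣d)) p-prime)

  square-class-∣⇒∣² : ∀ {A X Y M N} → A * (Y * Y * N) ≡ X * X * M → ¬ + p ∣ N → ¬ + p ∣ M →
                      (+ p ∣ X → + p ∣ Y → ⊥) → + p ∣ A → + p * + p ∣ A
  square-class-∣⇒∣² {A} {X} {Y} {M} {N} eq p∤N p∤M coprime p∣A@(divides b ≡.refl) with + p ∣? X
  ... | no p∤X = ⊥-elim (∤-* (∤-* p∤X p∤X) p∤M (≡.subst (+ p ∣_) eq (∣m⇒∣m*n (Y * Y * N) p∣A)))
  ... | yes p∣X@(divides x ≡.refl) =
    divides c (≡.trans (≡.cong (_* + p) b≡cp) (ℤ.*-assoc c (+ p) (+ p)))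
    where
    b*YYN≡xxM*p : b * (Y * Y * N) ≡ x * x * M * + p
    b*YYN≡xxM*p = ℤ.*-cancelˡ-≡ (+ p) _ _ (begin
      + p * (b * (Y * Y * N))   ≡⟨ ℤ.*-comm (+ p) _ ⟩
      b * (Y * Y * N) * + p     ≡⟨ rotate b (Y * Y * N) (+ p) ⟩
      b * + p * (Y * Y * N)     ≡⟨ eq ⟩
      x * + p * (x * + p) * M   ≡⟨ regroup x M (+ p) ⟩
      + p * (x * x * M * + p)   ∎)
      where
      open ≡-Reasoning
      rotate : ∀ b z p → b * z * p ≡ b * p * z
      rotate = solve-∀
      regroup : ∀ x m p → x * p * (x * p) * m ≡ p * (x * x * m * p)
      regroup = solve-∀
    p∤YYN : ¬ + p ∣ Y * Y * N
    p∤YYN = ∤-* (∤-* (coprime p∣X) (coprime p∣X)) p∤N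
    p∣b : + p ∣ b
    p∣b = ∣*∤⇒∣ (divides (x * x * M) b*YYN≡xxM*p) p∤YYN
    c : ℤ
    c = _∣_.quotient p∣b
    b≡cp : b ≡ c * + p
    b≡cp = _∣_.equality p∣b

  square-class-∤⇒∤ : ∀ {A X Y M N} → A * (Y * Y * N) ≡ X * X * M → ¬ + p ∣ N → ¬ + p ∣ M →
                     (+ p ∣ X → + p ∣ Y → ⊥) → ¬ + p ∣ A → ¬ + p ∣ X × ¬ + p ∣ Y
  square-class-∤⇒∤ {A} {X} {Y} {M} {N} eq p∤N p∤M coprime p∤A = p∤X , p∤Y
    where
    p∤X : ¬ + p ∣ X
    p∤X p∣X = coprime p∣X (∣²⇒∣ (∣*∤⇒∣ (∣*∤⇒∣ p∣YYN*A p∤A) p∤N))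
      where
      p∣YYN*A : + p ∣ Y * Y * N * A
      p∣YYN*A = ≡.subst (+ p ∣_) (≡.trans (≡.sym eq) (ℤ.*-comm A _)) (∣m⇒∣m*n M (∣m⇒∣m*n X p∣X))
    p∤Y : ¬ + p ∣ Y
    p∤Y p∣Y = coprime (∣²⇒∣ (∣*∤⇒∣ p∣XXM p∤M)) p∣Y
      where
      p∣XXM : + p ∣ X * X * M
      p∣XXM = ≡.subst (+ p ∣_) eq (∣n⇒∣m*n A (∣m⇒∣m*n N (∣m⇒∣m*n Y p∣Y)))

  infix 4 _⇝ᵘ_ _⇝_

  record _⇝ᵘ_ (x : ℚᵘ) (z : ℤ) : Set where
    constructor reducesᵘ
    field
      p∤↧    : ¬ + p ∣ ↧ᵘ x
      p∣↥-z↧ : + p ∣ ↥ᵘ x - z * ↧ᵘ x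

  record _⇝_ (q : ℚ) (z : ℤ) : Set where
    constructor reduces
    field
      p∤↧    : ¬ + p ∣ ↧ q
      p∣↥-z↧ : + p ∣ ↥ q - z * ↧ q

  record Unit (q : ℚ) : Set where
    constructor unit
    field
      p∤↥ : ¬ + p ∣ ↥ q
      p∤↧ : ¬ + p ∣ ↧ q

  ⇝ᵘ-* : ∀ {x y z w} → x ⇝ᵘ z → y ⇝ᵘ w → x ℚᵘ.* y ⇝ᵘ z * w
  ⇝ᵘ-* {mkℚᵘ a b} {mkℚᵘ c d} {z} {w} (reducesᵘ p∤b hx) (reducesᵘ p∤d hy) =
    reducesᵘ (∤-* p∤b p∤d) (≡.subst (+ p ∣_) (expand a (+ suc b) c (+ suc d) z w)
                             (∣m∣n⇒∣m+n (∣n⇒∣m*n c hx) (∣n⇒∣m*n (z * + suc b) hy)))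
    where
    expand : ∀ a b c d z w → c * (a - z * b) + z * b * (c - w * d) ≡ a * c - z * w * (b * d)
    expand = solve-∀

  ⇝ᵘ-+ : ∀ {x y z w} → x ⇝ᵘ z → y ⇝ᵘ w → x ℚᵘ.+ y ⇝ᵘ z + w
  ⇝ᵘ-+ {mkℚᵘ a b} {mkℚᵘ c d} {z} {w} (reducesᵘ p∤b hx) (reducesᵘ p∤d hy) =
    reducesᵘ (∤-* p∤b p∤d) (≡.subst (+ p ∣_) (expand a (+ suc b) c (+ suc d) z w)
                             (∣m∣n⇒∣m+n (∣n⇒∣m*n (+ suc d) hx) (∣n⇒∣m*n (+ suc b) hy)))
    where
    expand : ∀ a b c d z w → d * (a - z * b) + b * (c - w * d) ≡ (a * d + c * b) - (z + w) * (b * d)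
    expand = solve-∀

  ⇝ᵘ-neg : ∀ {x z} → x ⇝ᵘ z → ℚᵘ.- x ⇝ᵘ - z
  ⇝ᵘ-neg {mkℚᵘ a b} {z} (reducesᵘ p∤b hx) =
    reducesᵘ p∤b (≡.subst (+ p ∣_) (expand a (+ suc b) z) (∣m⇒∣-m hx))
    where
    expand : ∀ a b z → - (a - z * b) ≡ - a - (- z) * b
    expand = solve-∀

  ⇝⇒⇝ᵘ : ∀ {q z} → q ⇝ z → toℚᵘ q ⇝ᵘ z
  ⇝⇒⇝ᵘ {mkℚ _ _ _} (reduces p∤↧ p∣↥-z↧) = reducesᵘ p∤↧ p∣↥-z↧

  ⇝ᵘ⇒⇝ : ∀ {q x z} → toℚᵘ q ≃ᵘ x → x ⇝ᵘ z → q ⇝ z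
  ⇝ᵘ⇒⇝ {q@(mkℚ n d _)} {mkℚᵘ m e} {z} (*≡* eq) (reducesᵘ p∤e hx) = reduces p∤d (∣*∤⇒∣ p∣ p∤e)
    where
    p∤d : ¬ + p ∣ + suc d
    p∤d p∣d = ↥↧-coprime q (∣*∤⇒∣ (≡.subst (+ p ∣_) (≡.sym eq) (∣n⇒∣m*n m p∣d)) p∤e) p∣d
    p∣ : + p ∣ (n - z * + suc d) * + suc e
    p∣ = ≡.subst (+ p ∣_) (begin
      + suc d * (m - z * + suc e)          ≡⟨ distrib (+ suc d) m (z * + suc e) ⟩
      m * + suc d - z * + suc e * + suc d  ≡⟨ ≡.cong (_- z * + suc e * + suc d) eq ⟨
      n * + suc e - z * + suc e * + suc d  ≡⟨ regroup n (+ suc d) (+ suc e) z ⟩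
      (n - z * + suc d) * + suc e          ∎) (∣n⇒∣m*n (+ suc d) hx)
      where
      open ≡-Reasoning
      distrib : ∀ d m x → d * (m - x) ≡ m * d - x * d
      distrib = solve-∀
      regroup : ∀ n d e z → n * e - z * e * d ≡ (n - z * d) * e
      regroup = solve-∀

  ⇝-* : ∀ {x y z w} → x ⇝ z → y ⇝ w → x ℚ.* y ⇝ z * w
  ⇝-* {x} {y} hx hy = ⇝ᵘ⇒⇝ (ℚ.toℚᵘ-homo-* x y) (⇝ᵘ-* (⇝⇒⇝ᵘ hx) (⇝⇒⇝ᵘ hy))

  ⇝-+ : ∀ {x y z w} → x ⇝ z → y ⇝ w → x ℚ.+ y ⇝ z + w
  ⇝-+ {x} {y} hx hy = ⇝ᵘ⇒⇝ (ℚ.toℚᵘ-homo-+ x y) (⇝ᵘ-+ (⇝⇒⇝ᵘ hx) (⇝⇒⇝ᵘ hy))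

  ⇝-neg : ∀ {x z} → x ⇝ z → ℚ.- x ⇝ - z
  ⇝-neg {x} hx = ⇝ᵘ⇒⇝ (ℚ.toℚᵘ-homo‿- x) (⇝ᵘ-neg (⇝⇒⇝ᵘ hx))

  ⇝-sub : ∀ {x y z w} → x ⇝ z → y ⇝ w → x ℚ.- y ⇝ z - w
  ⇝-sub hx hy = ⇝-+ hx (⇝-neg hy)

  ⇝-∣↥⇒∣ : ∀ {q z} → q ⇝ z → + p ∣ ↥ q → + p ∣ z
  ⇝-∣↥⇒∣ {q} {z} (reduces p∤↧ h) p∣↥ =
    ∣*∤⇒∣ (≡.subst (+ p ∣_) (cancel (↥ q) z (↧ q)) (∣m∣n⇒∣m-n p∣↥ h)) p∤↧
    where
    cancel : ∀ n z d → n - (n - z * d) ≡ z * d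
    cancel = solve-∀

  ⇝-∣⇒∣↥ : ∀ {q z} → q ⇝ z → + p ∣ z → + p ∣ ↥ q
  ⇝-∣⇒∣↥ {q} {z} (reduces _ h) p∣z =
    ≡.subst (+ p ∣_) (cancel (↥ q) z (↧ q)) (∣m∣n⇒∣m+n h (∣m⇒∣m*n (↧ q) p∣z))
    where
    cancel : ∀ n z d → (n - z * d) + z * d ≡ n
    cancel = solve-∀

  ⇝-exists : ∀ q → ¬ + p ∣ ↧ q → ∃ (q ⇝_)
  ⇝-exists q p∤↧ with inverse-mod p∤↧
  ... | t , p∣1-t↧ =
    ↥ q * t , reduces p∤↧ (≡.subst (+ p ∣_) (expand (↥ q) t (↧ q)) (∣n⇒∣m*n (↥ q) p∣1-t↧))
    where
    expand : ∀ n t d → n * (1ℤ - t * d) ≡ n - n * t * d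
    expand = solve-∀

  ⇝⇒Unit⊎∣ : ∀ {q z} → q ⇝ z → Unit q ⊎ + p ∣ z
  ⇝⇒Unit⊎∣ {q} q⇝z with + p ∣? ↥ q
  ... | no p∤↥  = inj₁ (unit p∤↥ (_⇝_.p∤↧ q⇝z))
  ... | yes p∣↥ = inj₂ (⇝-∣↥⇒∣ q⇝z p∣↥)

  Unit-* : ∀ {x y} → Unit x → Unit y → Unit (x ℚ.* y)
  Unit-* {x} {y} (unit p∤↥x p∤↧x) (unit p∤↥y p∤↧y) =
    let z , x⇝z = ⇝-exists x p∤↧x
        w , y⇝w = ⇝-exists y p∤↧y
        xy⇝zw   = ⇝-* x⇝z y⇝w
    in unit (∤-* (p∤↥x ∘ ⇝-∣⇒∣↥ x⇝z) (p∤↥y ∘ ⇝-∣⇒∣↥ y⇝w) ∘ ⇝-∣↥⇒∣ xy⇝zw) (_⇝_.p∤↧ xy⇝zw)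

  Unit-1 : Unit ℚ.1ℚ
  Unit-1 = unit p∤1 p∤1

  Unit-if : ∀ c {x} → Unit x → Unit (if c then x else ℚ.1ℚ)
  Unit-if true  x-unit = x-unit
  Unit-if false _      = Unit-1

  Unit-prodFin : ∀ n (b : Fin n → ℚ) → (∀ i → Unit (b i)) → Unit (prodFin n b)
  Unit-prodFin zero    b units = Unit-1
  Unit-prodFin (suc n) b units = Unit-* (units zero) (Unit-prodFin n (b ∘ suc) (units ∘ suc))

  vₚ≡0⇒Unit : ∀ q → ↥ q ≢ 0ℤ → vₚ p q ≡ 0ℤ → Unit q
  vₚ≡0⇒Unit q ↥q≢0 vₚ≡0 = unit p∤↥ p∤↧
    where
    same-valuation : valℕ p ℤ.∣ ↥ q ∣ ≡ valℕ p (↧ₙ q)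
    same-valuation = ℤ.+-injective (ℤ.i-j≡0⇒i≡j _ _ vₚ≡0)
    p∤↧ : ¬ + p ∣ ↧ q
    p∤↧ p∣↧ = ↥↧-coprime q p∣↥ p∣↧
      where
      p∣↥ : + p ∣ ↥ q
      p∣↥ = ∣ᵤ⇒∣ (valℕ≢0⇒∣ p _
        (≡.subst (_≢ 0) (≡.sym same-valuation) (∣⇒valℕ≢0 (λ ()) (∣⇒∣ᵤ p∣↧))))
    p∤↥ : ¬ + p ∣ ↥ q
    p∤↥ p∣↥ = p∤↧ (∣ᵤ⇒∣ (valℕ≢0⇒∣ p _
      (≡.subst (_≢ 0) same-valuation (∣⇒valℕ≢0 (↥q≢0 ∘ ℤ.∣i∣≡0⇒i≡0) (∣⇒∣ᵤ p∣↥)))))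

  Unit[toℚ*q²]⇒∤×Unit : ∀ A q → ¬ + p * + p ∣ A → Unit (toℚ A ℚ.* (q ℚ.* q)) → ¬ + p ∣ A × Unit q
  Unit[toℚ*q²]⇒∤×Unit A q p²∤A (unit p∤↥ p∤↧) = p∤A , unit (proj₂ p∤q) (proj₁ p∤q)
    where
    eq : A * (↥ q * ↥ q * ↧ (toℚ A ℚ.* (q ℚ.* q))) ≡ ↧ q * ↧ q * ↥ (toℚ A ℚ.* (q ℚ.* q))
    eq = toℚ*q²≡x⇒cross A q _ ≡.refl
    coprime : + p ∣ ↧ q → + p ∣ ↥ q → ⊥
    coprime p∣↧ p∣↥ = ↥↧-coprime q p∣↥ p∣↧
    p∤A : ¬ + p ∣ A
    p∤A = p²∤A ∘ square-class-∣⇒∣² eq p∤↧ p∤↥ coprime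
    p∤q : ¬ + p ∣ ↧ q × ¬ + p ∣ ↥ q
    p∤q = square-class-∤⇒∤ eq p∤↧ p∤↥ coprime p∤A

  squarefree-∉-unit-span : ∀ {n b a} → (∀ i → Unit (b i)) → SquarefreeInt a → InSpan n b (toℚ a) →
                           ¬ p ℕ.∣ ℤ.∣ a ∣
  squarefree-∉-unit-span {n} {b} {a} units (_ , squarefree) (e , q , _ , a≡qqv) p∣a =
    squarefree p p-prime (≡.subst (ℕ._∣ ℤ.∣ a ∣) (ℤ.abs-* (+ p) (+ p)) (∣⇒∣ᵤ p²∣a))
    where
    v : ℚ
    v = prodFin n (λ i → if e i then b i else ℚ.1ℚ)
    unit-v : Unit v
    unit-v = Unit-prodFin n _ (λ i → Unit-if (e i) (units i))
    p²∣a : + p * + p ∣ a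
    p²∣a = square-class-∣⇒∣² (toℚ≡q²v⇒cross a q v a≡qqv) (Unit.p∤↧ unit-v) (Unit.p∤↥ unit-v)
                             (↥↧-coprime q) (∣ᵤ⇒∣ {i = a} p∣a)

  module _ {u : ℚ} {w : ℤ} (u⇝w : u ⇝ w) where

    orbit-suc-⇝ : ∀ k → orbit u (suc k) ⇝ zeroOrbit w (suc (suc k))
    orbit-suc-⇝ zero    = ≡.subst (orbit u 1 ⇝_) (expand w) (⇝-sub (⇝-* uu⇝ww uu⇝ww) uu⇝ww)
      where
      uu⇝ww : u ℚ.* u ⇝ w * w
      uu⇝ww = ⇝-* u⇝w u⇝w
      expand : ∀ w → w * w * (w * w) - w * w ≡ (0ℤ * 0ℤ - w * w) * (0ℤ * 0ℤ - w * w) - w * w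
      expand = solve-∀
    orbit-suc-⇝ (suc k) = ⇝-sub (⇝-* (orbit-suc-⇝ k) (orbit-suc-⇝ k)) (⇝-* u⇝w u⇝w)

    gensMinus-Unit⊎∣ : ∀ {n} i → Unit (gensMinus u n i) ⊎ + p ∣ zeroOrbit w (suc (toℕ i)) + w
    gensMinus-Unit⊎∣ zero    =
      Sum.map₂ (≡.subst (+ p ∣_) (negate w) ∘ ∣m⇒∣-m) (⇝⇒Unit⊎∣ (⇝-sub (⇝-* u⇝w u⇝w) u⇝w))
      where
      negate : ∀ w → - (w * w - w) ≡ (0ℤ * 0ℤ - w * w) + w
      negate = solve-∀
    gensMinus-Unit⊎∣ (suc i) = ⇝⇒Unit⊎∣ (⇝-+ (orbit-suc-⇝ (toℕ i)) u⇝w)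

    gensPlus-Unit⊎∣ : ∀ {n} i → Unit (gensPlus u n i) ⊎ + p ∣ zeroOrbit w (suc (toℕ i)) - w
    gensPlus-Unit⊎∣ zero    =
      Sum.map₂ (≡.subst (+ p ∣_) (negate w) ∘ ∣m⇒∣-m) (⇝⇒Unit⊎∣ (⇝-+ (⇝-* u⇝w u⇝w) u⇝w))
      where
      negate : ∀ w → - (w * w + w) ≡ (0ℤ * 0ℤ - w * w) - w
      negate = solve-∀
    gensPlus-Unit⊎∣ (suc i) = ⇝⇒Unit⊎∣ (⇝-sub (orbit-suc-⇝ (toℕ i)) u⇝w)

    gensMinus⊎gensPlus-Unit : ¬ + p ∣ + 2 → ¬ + p ∣ w → ∀ n →
                              (∀ i → Unit (gensMinus u n i)) ⊎ (∀ i → Unit (gensPlus u n i))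
    gensMinus⊎gensPlus-Unit p∤2 p∤w n with ∀⊎∃ gensMinus-Unit⊎∣
    ... | inj₁ minus-units = inj₁ minus-units
    ... | inj₂ (i , p∣xᵢ₊₁+w) = inj₂ λ j → [ id , (λ p∣xⱼ₊₁-w → ⊥-elim (∤-* p∤2 p∤w
            (∣zeroOrbit±w⇒∣2w w (suc (toℕ i)) (suc (toℕ j)) p∣xᵢ₊₁+w p∣xⱼ₊₁-w))) ] (gensPlus-Unit⊎∣ j)

lemma5p11 : (u : ℚ) → u ≢ ℚ.0ℚ → (n : ℕ) → n ≥ 1 →
    (∀ (i : Fin n) → gensMinus u n i ≢ ℚ.0ℚ) →
    (∀ (i : Fin n) → gensPlus u n i ≢ ℚ.0ℚ) →
    (a : ℤ) → SquarefreeInt a →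
    InSpan n (gensMinus u n) (toℚ a) →
    InSpan n (gensPlus u n) (toℚ a) →
    (p : ℕ) → Prime p → p ℕ.∣ ℤ.∣ a ∣ →
    vₚ p (toℚ (+ 2) ℚ.* orbit u 0) ≢ ℤ.0ℤ
lemma5p11 u u≢0 n _ _ _ a squarefree in-minus in-plus p p-prime p∣a vₚ≡0 =
  [ excluded in-minus , excluded in-plus ] (gensMinus⊎gensPlus-Unit p-prime u⇝w p∤2 p∤w n)
  where
  unit-2uu : Unit p-prime (toℚ (+ 2) ℚ.* orbit u 0)
  unit-2uu = vₚ≡0⇒Unit p-prime _ (↥[toℚ*q²]≢0 (+ 2) u (λ ()) u≢0) vₚ≡0
  p∤2 : ¬ + p ∣ + 2
  p∤2 = proj₁ (Unit[toℚ*q²]⇒∤×Unit p-prime (+ 2) u (p²∤2 p-prime) unit-2uu)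
  unit-u : Unit p-prime u
  unit-u = proj₂ (Unit[toℚ*q²]⇒∤×Unit p-prime (+ 2) u (p²∤2 p-prime) unit-2uu)
  w : ℤ
  w = proj₁ (⇝-exists p-prime u (Unit.p∤↧ unit-u))
  u⇝w : _⇝_ p-prime u w
  u⇝w = proj₂ (⇝-exists p-prime u (Unit.p∤↧ unit-u))
  p∤w : ¬ + p ∣ w
  p∤w = Unit.p∤↥ unit-u ∘ ⇝-∣⇒∣↥ p-prime u⇝w
  excluded : ∀ {b} → InSpan n b (toℚ a) → (∀ i → Unit p-prime (b i)) → ⊥
  excluded in-span units = squarefree-∉-unit-span p-prime units squarefree in-span p∣a
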